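{- Let $K$ be a $^*$-continuous KAT with top, $A$ a top Kleene abstract domain of $K$ with maps $\alpha,\gamma$, and $T_{\Sigma,B}$ a KAT language interpreted on $K$ through a pair-valued evaluation. Let $t\in T_{\Sigma,B}$ be such that for every atom $\mathtt a$ occurring in $t$, $A$ is globally complete for both $\llbracket\mathtt a\rrbracket_{ok}$ and $\llbracket\mathtt a\rrbracket_{err}$. For all $a,b,c\in K$, if $[a]\,t\,[ok:b][err:c]$ is valid, then it is derivable in $\mathrm{LCTIL}_A$.
   Context: Idempotent semiring: $(K,+,0)$ commutative monoid with $a+a=a$, $(K,\cdot,1)$ monoid, two-sided distributivity, $0a=a0=0$; $a\le b$ iff $a+b=b$. KAT: idempotent semiring with Boolean subalgebra $\mathrm{Test}(K)$ (join $+$, meet $\cdot$, complement, bottom $0$, top $1$) and ${}^*$ with $1+aa^*\le a^*$, $1+a^*a\le a^*$, $b+ac\le c\Rightarrow a^*b\le c$, $b+ca\le c\Rightarrow ba^*\le c$. TopKAT: KAT with greatest element $\top$; $^*$-continuous: $\bigvee_nab^nc$ exists and equals $ab^*c$ for all $a,b,c$. $\mathrm{TOP}(K)=\{\top a\mid a\in K\}$. Language: disjoint $\Sigma,B$ ($\mathtt0,\mathtt1\in B$), $\mathrm{Atom}=\Sigma\cup B$, terms $t::=\mathtt a\mid\mathtt0\mid\mathtt1\mid t_1+t_2\mid t_1\cdot t_2\mid t^*$. Evaluation $u:\mathrm{Atom}\to K\times K$ induces $\llbracket t\rrbracket=(\llbracket t\rrbracket_{ok},\llbracket t\rrbracket_{err})$: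 $\llbracket\mathtt a\rrbracket=u(\mathtt a)$; $\llbracket t_1+t_2\rrbracket$ componentwise sum; $\llbracket t_1\cdot t_2\rrbracket=(\llbracket t_1\rrbracket_{ok}\llbracket t_2\rrbracket_{ok},\llbracket t_1\rrbracket_{err}+\llbracket t_1\rrbracket_{ok}\llbracket t_2\rrbracket_{err})$; $\llbracket t^*\rrbracket=(\llbracket t\rrbracket_{ok}^*,\llbracket t\rrbracket_{ok}^*\llbracket t\rrbracket_{err})$. Top Kleene abstract domain: poset $A$, Galois insertion $\alpha:\mathrm{TOP}(K)\to A$, $\gamma:A\to\mathrm{TOP}(K)$ ($\alpha(x)\le_Ay\iff x\le\gamma(y)$, $\alpha\gamma=\mathrm{id}$), countably complete. Abstract semantics ($\varepsilon\in\{ok,err\}$): $\mathcal S^\sharp_\varepsilon[\mathtt c]x=\alpha(\gamma(x)\llbracket\mathtt c\rrbracket_\varepsilon)$; $\mathcal S^\sharp_\varepsilon[t_1+t_2]x=\mathcal S^\sharp_\varepsilon[t_1]x\vee_A\mathcal S^\sharp_\varepsilon[t_2]x$; $\mathcal S^\sharp_{ok}[t_1\cdot t_2]x=\mathcal S^\sharp_{ok}[t_2](\mathcal S^\sharp_{ok}[t_1]x)$; $\mathcal S^\sharp_{err}[t_1\cdot t_2]x=\mathcal S^\sharp_{err}[t_1]x\vee_A\mathcal S^\sharp_{err}[t_2](\mathcal S^\sharp_{ok}[t_1]x)$; $\mathcal S^\sharp_{ok}[t^*]x=\bigvee_n(\mathcal S^\sharp_{ok}[t])^nx$; $\mathcal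 S^\sharp_{err}[t^*]x=\mathcal S^\sharp_{err}[t](\bigvee_n(\mathcal S^\sharp_{ok}[t])^nx)$. $A(x):=\gamma\alpha(x)$; $\mathbb C^A_b(c)$ iff $A(\top bc)=A(A(\top b)c)$; $A$ is globally complete for $c$ iff $\mathbb C^A_b(c)$ for every $b\in K$. Triples $[a]t[\varepsilon:b]$, valid iff $\top b\le\top a\llbracket t\rrbracket_\varepsilon$ and $\mathcal S^\sharp_\varepsilon[t]\alpha(\top a)=\alpha(\top b)=\alpha(\top a\llbracket t\rrbracket_\varepsilon)$; $[a]t[ok:b][err:c]$ is valid (derivable) iff both $[a]t[ok:b]$ and $[a]t[err:c]$ are. $\mathrm{LCTIL}_A$ rules ($\varepsilon$-rules are schemes for each $\varepsilon$): (transfer) $\mathtt c\in\mathrm{Atom}$, $\mathbb C^A_a(\llbracket\mathtt c\rrbracket_{ok})$, $\mathbb C^A_a(\llbracket\mathtt c\rrbracket_{err})$ $\vdash[a]\mathtt c[ok:a\llbracket\mathtt c\rrbracket_{ok}][err:a\llbracket\mathtt c\rrbracket_{err}]$; (relax) $\top a'\le\top a\le A(\top a')$, $[a']t[\varepsilon:b']$, $\top b\le\top b'\le A(\top b)$ $\vdash[a]t[\varepsilon:b]$; (seq-ok) $[a]t_1[ok:r]$, $[r]t_2[ok:b]$ $\vdash[a]t_1\cdot t_2[ok:b]$; (seq-err) $[a]t_1[ok:b][err:r]$, $[b]t_2[err:s]$ $\vdash[a]t_1\cdot t_2[err:r+s]$; (rec-err) $[a]t^*[ok:b]$, $[b]t[err:r]$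 $\vdash[a]t^*[err:r]$; (join) $[a]t_1[\varepsilon:b_1]$, $[a]t_2[\varepsilon:b_2]$ $\vdash[a]t_1+t_2[\varepsilon:b_1+b_2]$; (limit) $[a_n]t[ok:a_{n+1}]$ for all $n$ $\vdash[a_0]t^*[ok:\bigvee_na_n]$, applicable only when $\bigvee_na_n$ exists and $\top\bigvee_na_n=\bigvee_n\top a_n$. -}

module Defs where

open import Data.Nat using (ℕ; zero; suc)
open import Data.Product using (Σ; ∃; _×_; _,_; proj₁; proj₂)
open import Data.Sum using (_⊎_; inj₁; inj₂)
open import Relation.Binary.PropositionalEquality using (_≡_)

record IdempotentSemiring : Set₁ where
  infixl 6 _+_
  infixl 7 _·_
  field
    Carrier     : Set
    _+_ _·_     : Carrier → Carrier → Carrier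
    0# 1#       : Carrier
    +-assoc     : ∀ a b c → (a + b) + c ≡ a + (b + c)
    +-comm      : ∀ a b → a + b ≡ b + a
    +-identityˡ : ∀ a → 0# + a ≡ a
    +-idem      : ∀ a → a + a ≡ a
    ·-assoc     : ∀ a b c → (a · b) · c ≡ a · (b · c)
    ·-identityˡ : ∀ a → 1# · a ≡ a
    ·-identityʳ : ∀ a → a · 1# ≡ a
    distribˡ    : ∀ a b c → a · (b + c) ≡ (a · b) + (a · c)
    distribʳ    : ∀ a b c → (a + b) · c ≡ (a · c) + (b · c)
    zeroˡ       : ∀ a → 0# · a ≡ 0#
    zeroʳ       : ∀ a → a · 0# ≡ 0#

  infix 4 _≤_
  _≤_ : Carrier → Carrier → Set
  a ≤ b = a + b ≡ b

  pow : Carrier → ℕ → Carrier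
  pow b zero    = 1#
  pow b (suc n) = b · pow b n

  IsSup : (ℕ → Carrier) → Carrier → Set
  IsSup f s = (∀ n → f n ≤ s) × (∀ u → (∀ n → f n ≤ u) → s ≤ u)

record StarContTopKAT : Set₁ where
  field
    semiring : IdempotentSemiring
  open IdempotentSemiring semiring public
  field
    Test        : Carrier → Set
    test-0      : Test 0#
    test-1      : Test 1#
    test-+      : ∀ p q → Test p → Test q → Test (p + q)
    test-·      : ∀ p q → Test p → Test q → Test (p · q)
    test-·-comm : ∀ p q → Test p → Test q → p · q ≡ q · p
    test-·-idem : ∀ p → Test p → p · p ≡ p
    test-compl  : ∀ p → Test p → Σ Carrier λ q → Test q × (p + q ≡ 1#) × (p · q ≡ 0#)
    _*          : Carrier → Carrier
    star-unfoldˡ : ∀ a → 1# + a · (a *) ≤ a *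
    star-unfoldʳ : ∀ a → 1# + (a *) · a ≤ a *
    star-indˡ    : ∀ a b c → b + a · c ≤ c → (a *) · b ≤ c
    star-indʳ    : ∀ a b c → b + c · a ≤ c → b · (a *) ≤ c
    ⊤           : Carrier
    ⊤-max       : ∀ a → a ≤ ⊤
    star-cont   : ∀ a b c → IsSup (λ n → a · pow b n · c) (a · (b *) · c)

  InTOP : Carrier → Set
  InTOP x = ∃ λ a → x ≡ ⊤ · a

record TopKleeneAbsDomain (K : StarContTopKAT) : Set₁ where
  open StarContTopKAT K
  field
    Abs      : Set
    _⊑_      : Abs → Abs → Set
    ⊑-refl   : ∀ x → x ⊑ x
    ⊑-trans  : ∀ x y z → x ⊑ y → y ⊑ z → x ⊑ z
    ⊑-antisym : ∀ x y → x ⊑ y → y ⊑ x → x ≡ y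
    -- α : TOP(K) → A  (only its values on TOP(K) are constrained/used)
    α        : Carrier → Abs
    γ        : Abs → Carrier
    γ-TOP    : ∀ y → InTOP (γ y)
    galois→  : ∀ x y → InTOP x → α x ⊑ y → x ≤ γ y
    galois←  : ∀ x y → InTOP x → x ≤ γ y → α x ⊑ y
    αγ≡id    : ∀ y → α (γ y) ≡ y
    ⋁        : (ℕ → Abs) → Abs
    ⋁-ub     : ∀ f n → f n ⊑ ⋁ f
    ⋁-least  : ∀ f y → (∀ n → f n ⊑ y) → ⋁ f ⊑ y

  _∨_ : Abs → Abs → Abs
  x ∨ y = ⋁ λ { zero → x ; (suc _) → y }

  Aop : Carrier → Carrier
  Aop x = γ (α x)

  Complete : Carrier → Carrier → Set
  Complete b c = Aop (⊤ · b · c) ≡ Aop (Aop (⊤ · b) · c)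

  GloballyComplete : Carrier → Set
  GloballyComplete c = ∀ b → Complete b c

record TestAlphabet : Set₁ where
  field
    B   : Set
    𝟎 𝟏 : B

Atom : Set → TestAlphabet → Set
Atom Σ' Bs = Σ' ⊎ TestAlphabet.B Bs

data Term (At : Set) : Set where
  atom : At → Term At
  _⊕_  : Term At → Term At → Term At
  _⊗_  : Term At → Term At → Term At
  _⋆   : Term At → Term At

AllAtoms : {At : Set} → (At → Set) → Term At → Set
AllAtoms P (atom c)  = P c
AllAtoms P (t₁ ⊕ t₂) = AllAtoms P t₁ × AllAtoms P t₂
AllAtoms P (t₁ ⊗ t₂) = AllAtoms P t₁ × AllAtoms P t₂
AllAtoms P (t ⋆)     = AllAtoms P t

data Res : Set where
  ok err : Res

module Sem (K : StarContTopKAT) (D : TopKleeneAbsDomain K) {At : Set}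
           (u : At → StarContTopKAT.Carrier K × StarContTopKAT.Carrier K) where
  open StarContTopKAT K
  open TopKleeneAbsDomain D

  ⟦_⟧ : Term At → Carrier × Carrier
  ⟦ atom c ⟧  = u c
  ⟦ t₁ ⊕ t₂ ⟧ = (proj₁ ⟦ t₁ ⟧ + proj₁ ⟦ t₂ ⟧) , (proj₂ ⟦ t₁ ⟧ + proj₂ ⟦ t₂ ⟧)
  ⟦ t₁ ⊗ t₂ ⟧ = (proj₁ ⟦ t₁ ⟧ · proj₁ ⟦ t₂ ⟧) , (proj₂ ⟦ t₁ ⟧ + proj₁ ⟦ t₁ ⟧ · proj₂ ⟦ t₂ ⟧)
  ⟦ t ⋆ ⟧     = (proj₁ ⟦ t ⟧ *) , ((proj₁ ⟦ t ⟧ *) · proj₂ ⟦ t ⟧)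

  ⟦_⟧[_] : Term At → Res → Carrier
  ⟦ t ⟧[ ok ]  = proj₁ ⟦ t ⟧
  ⟦ t ⟧[ err ] = proj₂ ⟦ t ⟧

  iter : (Abs → Abs) → ℕ → Abs → Abs
  iter f zero    x = x
  iter f (suc n) x = f (iter f n x)

  S♯ : Res → Term At → Abs → Abs
  S♯ ε   (atom c)  x = α (γ x · ⟦ atom c ⟧[ ε ])
  S♯ ε   (t₁ ⊕ t₂) x = S♯ ε t₁ x ∨ S♯ ε t₂ x
  S♯ ok  (t₁ ⊗ t₂) x = S♯ ok t₂ (S♯ ok t₁ x)
  S♯ err (t₁ ⊗ t₂) x = S♯ err t₁ x ∨ S♯ err t₂ (S♯ ok t₁ x)
  S♯ ok  (t ⋆)     x = ⋁ (λ n → iter (S♯ ok t) n x)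
  S♯ err (t ⋆)     x = S♯ err t (⋁ (λ n → iter (S♯ ok t) n x))

  Valid : Res → Carrier → Term At → Carrier → Set
  Valid ε a t b = (⊤ · b ≤ ⊤ · a · ⟦ t ⟧[ ε ])
                × (S♯ ε t (α (⊤ · a)) ≡ α (⊤ · b))
                × (α (⊤ · b) ≡ α (⊤ · a · ⟦ t ⟧[ ε ]))

  data ⊢[_]_[_∶_] : Carrier → Term At → Res → Carrier → Set where
    transfer : ∀ ε a c
             → Complete a (⟦ atom c ⟧[ ok ]) → Complete a (⟦ atom c ⟧[ err ])
             → ⊢[ a ] atom c [ ε ∶ a · ⟦ atom c ⟧[ ε ] ]
    relax    : ∀ ε a a' b b' t
             → ⊤ · a' ≤ ⊤ · a → ⊤ · a ≤ Aop (⊤ · a')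
             → ⊢[ a' ] t [ ε ∶ b' ]
             → ⊤ · b ≤ ⊤ · b' → ⊤ · b' ≤ Aop (⊤ · b)
             → ⊢[ a ] t [ ε ∶ b ]
    seq-ok   : ∀ a r b t₁ t₂
             → ⊢[ a ] t₁ [ ok ∶ r ] → ⊢[ r ] t₂ [ ok ∶ b ]
             → ⊢[ a ] t₁ ⊗ t₂ [ ok ∶ b ]
    seq-err  : ∀ a b r s t₁ t₂
             → ⊢[ a ] t₁ [ ok ∶ b ] → ⊢[ a ] t₁ [ err ∶ r ]
             → ⊢[ b ] t₂ [ err ∶ s ]
             → ⊢[ a ] t₁ ⊗ t₂ [ err ∶ r + s ]
    rec-err  : ∀ a b r t
             → ⊢[ a ] t ⋆ [ ok ∶ b ] → ⊢[ b ] t [ err ∶ r ]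
             → ⊢[ a ] t ⋆ [ err ∶ r ]
    join     : ∀ ε a b₁ b₂ t₁ t₂
             → ⊢[ a ] t₁ [ ε ∶ b₁ ] → ⊢[ a ] t₂ [ ε ∶ b₂ ]
             → ⊢[ a ] t₁ ⊕ t₂ [ ε ∶ b₁ + b₂ ]
    limit    : ∀ (as : ℕ → Carrier) (s : Carrier) t
             → (∀ n → ⊢[ as n ] t [ ok ∶ as (suc n) ])
             → IsSup as s
             → IsSup (λ n → ⊤ · as n) (⊤ · s)
             → ⊢[ as zero ] t ⋆ [ ok ∶ s ]

  Valid₂ : Carrier → Term At → Carrier → Carrier → Set
  Valid₂ a t b c = Valid ok a t b × Valid err a t c

  Derivable₂ : Carrier → Term At → Carrier → Carrier → Set
  Derivable₂ a t b c = ⊢[ a ] t [ ok ∶ b ] × ⊢[ a ] t [ err ∶ c ]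

  AtomsGloballyComplete : Term At → Set
  AtomsGloballyComplete t =
    AllAtoms (λ c → GloballyComplete (⟦ atom c ⟧[ ok ]) × GloballyComplete (⟦ atom c ⟧[ err ])) t

{-# OPTIONS --safe #-}
-- Every term has a derivable triple whose postcondition is its strongest one, a · ⟦t⟧_ε:
-- atoms by (transfer), which global completeness makes applicable for every precondition,
-- sums and sequences by (join), (seq-ok), (seq-err), and t* by (limit) along the chain
-- a · ⟦t⟧_okⁿ, whose suprema are supplied by *-continuity.  A valid triple [a] t [ε : b]
-- has ⊤b ≤ ⊤a⟦t⟧_ε and α(⊤b) = α(⊤a⟦t⟧_ε), which is exactly what (relax) needs to weaken
-- the strongest postcondition to b.
module Submission where

open import Defs
open import Data.Nat using (ℕ; zero; suc)
open import Data.Product using (_×_; _,_)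
open import Relation.Binary.PropositionalEquality

module SemiringProperties (S : IdempotentSemiring) where
  open IdempotentSemiring S

  pow-comm : ∀ b n → pow b n · b ≡ b · pow b n
  pow-comm b zero    = trans (·-identityˡ b) (sym (·-identityʳ b))
  pow-comm b (suc n) = trans (·-assoc b (pow b n) b) (cong (b ·_) (pow-comm b n))

  IsSup-cong : ∀ {f g s s'} → (∀ n → f n ≡ g n) → s ≡ s' → IsSup f s → IsSup g s'
  IsSup-cong {f} {g} {s} f≗g refl (ub , least) =
    (λ n → subst (_≤ s) (f≗g n) (ub n)) ,
    (λ v g≤v → least v (λ n → subst (_≤ v) (sym (f≗g n)) (g≤v n)))

module _ (K : StarContTopKAT) where
  open StarContTopKAT K
  open SemiringProperties semiring

  star-cont-pow : ∀ a b → IsSup (λ n → a · pow b n) (a · (b *))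
  star-cont-pow a b = IsSup-cong (λ n → ·-identityʳ _) (·-identityʳ _) (star-cont a b 1#)

  module _ (D : TopKleeneAbsDomain K) where
    open TopKleeneAbsDomain D

    Aop-extensive : ∀ x → InTOP x → x ≤ Aop x
    Aop-extensive x x∈TOP = galois→ x (α x) x∈TOP (⊑-refl (α x))

    module _ {At : Set} (u : At → Carrier × Carrier) where
      open Sem K D u

      ⊢-cast : ∀ {ε a a' t b b'} → a' ≡ a → b' ≡ b →
               ⊢[ a' ] t [ ε ∶ b' ] → ⊢[ a ] t [ ε ∶ b ]
      ⊢-cast refl refl d = d

      ⊢-star-ok : ∀ t → (∀ a → ⊢[ a ] t [ ok ∶ a · ⟦ t ⟧[ ok ] ]) →
                  ∀ a → ⊢[ a ] t ⋆ [ ok ∶ a · ⟦ t ⋆ ⟧[ ok ] ]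
      ⊢-star-ok t ⊢t a =
        ⊢-cast (·-identityʳ a) refl
          (limit chain (a · (o *)) t step (star-cont-pow a o)
            (IsSup-cong (λ n → ·-assoc ⊤ a _) (·-assoc ⊤ a _) (star-cont-pow (⊤ · a) o)))
        where
          o = ⟦ t ⟧[ ok ]
          chain : ℕ → Carrier
          chain n = a · pow o n
          step : ∀ n → ⊢[ chain n ] t [ ok ∶ chain (suc n) ]
          step n = ⊢-cast refl (trans (·-assoc a _ _) (cong (a ·_) (pow-comm o n))) (⊢t (chain n))

      ⊢-strongest : ∀ t → AtomsGloballyComplete t →
                    ∀ ε a → ⊢[ a ] t [ ε ∶ a · ⟦ t ⟧[ ε ] ]
      ⊢-strongest (atom c) (complete-ok , complete-err) ε a =
        transfer ε a c (complete-ok a) (complete-err a)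
      ⊢-strongest (t₁ ⊕ t₂) (h₁ , h₂) ok a =
        ⊢-cast refl (sym (distribˡ a _ _))
          (join ok a _ _ t₁ t₂ (⊢-strongest t₁ h₁ ok a) (⊢-strongest t₂ h₂ ok a))
      ⊢-strongest (t₁ ⊕ t₂) (h₁ , h₂) err a =
        ⊢-cast refl (sym (distribˡ a _ _))
          (join err a _ _ t₁ t₂ (⊢-strongest t₁ h₁ err a) (⊢-strongest t₂ h₂ err a))
      ⊢-strongest (t₁ ⊗ t₂) (h₁ , h₂) ok a =
        ⊢-cast refl (·-assoc a _ _)
          (seq-ok a _ _ t₁ t₂ (⊢-strongest t₁ h₁ ok a)
            (⊢-strongest t₂ h₂ ok (a · ⟦ t₁ ⟧[ ok ])))
      ⊢-strongest (t₁ ⊗ t₂) (h₁ , h₂) err a =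
        ⊢-cast refl (trans (cong (a · ⟦ t₁ ⟧[ err ] +_) (·-assoc a _ _)) (sym (distribˡ a _ _)))
          (seq-err a _ _ _ t₁ t₂ (⊢-strongest t₁ h₁ ok a) (⊢-strongest t₁ h₁ err a)
            (⊢-strongest t₂ h₂ err (a · ⟦ t₁ ⟧[ ok ])))
      ⊢-strongest (t ⋆) h ok a = ⊢-star-ok t (⊢-strongest t h ok) a
      ⊢-strongest (t ⋆) h err a =
        ⊢-cast refl (·-assoc a _ _)
          (rec-err a _ _ t (⊢-star-ok t (⊢-strongest t h ok) a)
            (⊢-strongest t h err (a · (⟦ t ⟧[ ok ] *))))

      valid⇒derivable : ∀ t → AtomsGloballyComplete t →
                        ∀ ε a b → Valid ε a t b → ⊢[ a ] t [ ε ∶ b ]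
      valid⇒derivable t h ε a b (⊤b≤⊤ae , _ , αb≡αae) =
        relax ε a a b (a · e) t (+-idem (⊤ · a)) (Aop-extensive (⊤ · a) (a , refl))
          (⊢-strongest t h ε a) ⊤b≤⊤[ae] ⊤[ae]≤A⊤b
        where
          e = ⟦ t ⟧[ ε ]
          ⊤b≤⊤[ae] : ⊤ · b ≤ ⊤ · (a · e)
          ⊤b≤⊤[ae] = subst (⊤ · b ≤_) (·-assoc ⊤ a e) ⊤b≤⊤ae
          ⊤[ae]≤A⊤b : ⊤ · (a · e) ≤ Aop (⊤ · b)
          ⊤[ae]≤A⊤b = subst (λ y → ⊤ · (a · e) ≤ γ y) (sym αb≡αae)
            (subst (λ x → x ≤ Aop (⊤ · a · e)) (·-assoc ⊤ a e)
              (Aop-extensive (⊤ · a · e) (a · e , ·-assoc ⊤ a e)))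

theorem13 : (K : StarContTopKAT) (D : TopKleeneAbsDomain K)
    (Σ' : Set) (Bs : TestAlphabet)
    (u : Atom Σ' Bs → StarContTopKAT.Carrier K × StarContTopKAT.Carrier K)
    (t : Term (Atom Σ' Bs)) →
    Sem.AtomsGloballyComplete K D u t →
    (a b c : StarContTopKAT.Carrier K) →
    Sem.Valid₂ K D u a t b c →
    Sem.Derivable₂ K D u a t b c
theorem13 K D Σ' Bs u t h a b c (valid-ok , valid-err) =
  valid⇒derivable K D u t h ok a b valid-ok , valid⇒derivable K D u t h err a c valid-err
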